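{- For every integer $n\ge 0$, each of the sets $\mathcal{S}_n(1\text{ - }23,\,21\text{ - }3)$, $\mathcal{S}_n(3\text{ - }21,\,23\text{ - }1)$, $\mathcal{S}_n(12\text{ - }3,\,1\text{ - }32)$, $\mathcal{S}_n(32\text{ - }1,\,3\text{ - }12)$ has cardinality $M_n$, the $n$th Motzkin number.
   Context: A permutation of $[n]=\{1,\dots,n\}$ is written as a word $\pi=a_1a_2\cdots a_n$. For a permutation $xyz$ of $\{1,2,3\}$: $\pi$ contains the pattern $x\text{ - }yz$ if there are indices $1\le i<j<n$ such that $a_i,a_j,a_{j+1}$ are in the same relative order as $x,y,z$; $\pi$ contains the pattern $xy\text{ - }z$ if there are indices $i$ and $k$ with $i+1<k\le n$ such that $a_i,a_{i+1},a_k$ are in the same relative order as $x,y,z$. $\pi$ avoids a pattern if it does not contain it. $\mathcal{S}_n(p,q)$ is the set of permutations of $[n]$ avoiding both $p$ and $q$. The Motzkin number $M_n$ is the number of ways of drawing any number of nonintersecting chords among $n$ points on a circle; equivalently $M_0=1$ and $M_{n+1}=M_n+\sum_{k=0}^{n-1}M_kM_{n-1-k}$. -}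

module Defs where

open import Data.Nat using (ℕ; zero; suc; _+_; _*_; _<_)
open import Data.Fin as Fin using (Fin; toℕ)
open import Data.Vec using (Vec; lookup)
open import Data.Product using (Σ; ∃; _×_; _,_)
open import Data.List using (List; length)
open import Data.List.Relation.Unary.Unique.Propositional using (Unique)
open import Data.List.Membership.Propositional using (_∈_)
open import Relation.Binary.PropositionalEquality using (_≡_)
open import Relation.Nullary using (¬_)
open import Function.Bundles using (_⇔_)

-- Motzkin numbers: M 0 = 1, M (n+1) = M n + Σ_{k=0}^{n-1} M k * M (n-1-k).
-- convolution n = Σ_{k=0}^{n-1} M k * M (n-1-k), defined via a helper
-- over explicit index lists to keep structural recursion.
motzkins : ℕ → List ℕ  -- motzkins n = [M (n-1), ..., M 0] (reversed prefix)
sumProd : List ℕ → List ℕ → ℕ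

open Data.List using ([]; _∷_; reverse)

motzkins zero = []
motzkins (suc n) with motzkins n
... | [] = 1 ∷ []
... | (m ∷ ms) = (m + sumProd ms (reverse ms)) ∷ m ∷ ms

sumProd [] _ = 0
sumProd (_ ∷ _) [] = 0
sumProd (a ∷ as) (b ∷ bs) = a * b + sumProd as bs

M : ℕ → ℕ
M n with motzkins (suc n)
... | [] = 0
... | (m ∷ _) = m

-- A word of length n over [n] (letters are Fin n, i.e. 0..n-1 standing for 1..n).
Word : ℕ → Set
Word n = Vec (Fin n) n

IsPerm : ∀ {n} → Word n → Set
IsPerm {n} w = ∀ (i j : Fin n) → lookup w i ≡ lookup w j → i ≡ j

_<ᶠ_ : ∀ {m} → Fin m → Fin m → Set
a <ᶠ b = toℕ a < toℕ b

SameOrder : ∀ {n} → (Fin n × Fin n × Fin n) → (Fin 3 × Fin 3 × Fin 3) → Set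
SameOrder {n} (a₁ , a₂ , a₃) (x , y , z) =
  ((a₁ <ᶠ a₂ → x <ᶠ y) × (x <ᶠ y → a₁ <ᶠ a₂)) ×
  ((a₁ <ᶠ a₃ → x <ᶠ z) × (x <ᶠ z → a₁ <ᶠ a₃)) ×
  ((a₂ <ᶠ a₃ → y <ᶠ z) × (y <ᶠ z → a₂ <ᶠ a₃)) ×
  ((a₂ <ᶠ a₁ → y <ᶠ x) × (y <ᶠ x → a₂ <ᶠ a₁)) ×
  ((a₃ <ᶠ a₁ → z <ᶠ x) × (z <ᶠ x → a₃ <ᶠ a₁)) ×
  ((a₃ <ᶠ a₂ → z <ᶠ y) × (z <ᶠ y → a₃ <ᶠ a₂))

ContainsDashFirst : ∀ {n} → (Fin 3 × Fin 3 × Fin 3) → Word n → Set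
ContainsDashFirst {n} p w =
  Σ (Fin n) λ i → Σ (Fin n) λ j → Σ (Fin n) λ j' →
    toℕ i < toℕ j × toℕ j' ≡ suc (toℕ j) ×
    SameOrder (lookup w i , lookup w j , lookup w j') p

ContainsDashLast : ∀ {n} → (Fin 3 × Fin 3 × Fin 3) → Word n → Set
ContainsDashLast {n} p w =
  Σ (Fin n) λ i → Σ (Fin n) λ i' → Σ (Fin n) λ k →
    toℕ i' ≡ suc (toℕ i) × toℕ i' < toℕ k ×
    SameOrder (lookup w i , lookup w i' , lookup w k) p

data Pattern : Set where
  _-_∙_ : Fin 3 → Fin 3 → Fin 3 → Pattern
  _∙_-_ : Fin 3 → Fin 3 → Fin 3 → Pattern

Contains : ∀ {n} → Pattern → Word n → Set
Contains (x - y ∙ z) w = ContainsDashFirst (x , y , z) w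
Contains (x ∙ y - z) w = ContainsDashLast (x , y , z) w

Avoids : ∀ {n} → Pattern → Word n → Set
Avoids p w = ¬ Contains p w

InS : ∀ n → Pattern → Pattern → Word n → Set
InS n p q w = IsPerm w × Avoids p w × Avoids q w

HasCard : ∀ n → Pattern → Pattern → ℕ → Set
HasCard n p q c =
  Σ (List (Word n)) λ L → Unique L × length L ≡ c ×
    (∀ w → (w ∈ L) ⇔ InS n p q w)

𝟏 𝟐 𝟑 : Fin 3
𝟏 = Fin.zero
𝟐 = Fin.suc Fin.zero
𝟑 = Fin.suc (Fin.suc Fin.zero)

module Submission where

-- In a permutation avoiding 1-23 and 21-3 the maximal letter stands first or second: anywhere
-- later it would complete an occurrence of 1-23 or of 21-3 with the two letters before it.
-- Deleting it, the permutations of [n+1] with the maximum first are the n-permutations of the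
-- class, and those with the maximum second are the words x (n+1) τ in which τ is in the class
-- and the first ascent of τ has its bottom below x. Grading by the level n − ascentBound, where
-- ascentBound is one more than the bottom of the first ascent (0 without ascents), the counts
-- T n k satisfy T (n+1) (k+1) = T n k + Σ_{k ≤ u < k+n} T (n−1) u, and strong induction with
-- the Motzkin recurrence gives Σ_{u ≥ k} T n u = Σ_m M (n−m) T m k; for k = 0 this is M n.
-- Complement and reverse carry S_n(1-23, 21-3) onto the other three classes.

open import Defs
open import Data.Empty using (⊥; ⊥-elim)
open import Data.Fin as Fin
  using (Fin; zero; suc; toℕ; fromℕ; fromℕ<; punchIn; punchOut; opposite)
open import Data.Fin.Properties
  using ( toℕ-injective; toℕ<n; toℕ≤pred[n]; toℕ-fromℕ; toℕ-fromℕ<; punchIn-injective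
        ; punchInᵢ≢i; punchIn-mono-≤; punchIn-cancel-≤; punchIn-punchOut; punchOut-injective
        ; pigeonhole; any?; opposite-prop; opposite-involutive )
  renaming (_≟_ to _≟ᶠ_; suc-injective to suc-injectiveᶠ)
open import Data.List as List using (List; []; _∷_; reverse; applyUpTo; applyDownFrom; _∷ʳ_)
open import Data.List.Membership.Propositional using (_∈_)
open import Data.List.Membership.Propositional.Properties
  using (∈-map⁺; ∈-map⁻; ∈-++⁺ˡ; ∈-++⁺ʳ; ∈-++⁻)
open import Data.List.Properties using (unfold-reverse; applyUpTo-∷ʳ; length-++; length-map)
open import Data.List.Relation.Unary.All as All using ()
open import Data.List.Relation.Unary.AllPairs using ([]; _∷_)
open import Data.List.Relation.Unary.Any using (here)
open import Data.List.Relation.Unary.Unique.Propositional using (Unique)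
open import Data.List.Relation.Unary.Unique.Propositional.Properties as Unique using ()
open import Data.Nat using (ℕ; zero; suc; _+_; _*_; _∸_; _≤_; _<_; z≤n; s≤s)
open import Data.Nat.Induction using (<-rec)
open import Data.Nat.Properties
open import Algebra.Properties.CommutativeSemigroup +-commutativeSemigroup using (interchange)
open import Data.Product using (Σ; ∃-syntax; _×_; _,_; proj₁; proj₂)
open import Data.Sum as Sum using (_⊎_; inj₁; inj₂; [_,_])
open import Data.Vec as Vec using (Vec; []; _∷_; lookup)
open import Data.Vec.Membership.Propositional.Properties using (∈-lookup; toAny)
open import Data.Vec.Properties
  using ( lookup-map; map-∘; map-cong; map-id; lookup∘tabulate; tabulate∘lookup; tabulate-cong
        ; ∷-injective; ∷-injectiveˡ; ∷-injectiveʳ )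
open import Data.Vec.Relation.Unary.Any as Anyᵛ using (here)
open import Data.Vec.Relation.Unary.Any.Properties as Anyᵛ using (lookup-index)
open import Function using (_∘_; case_of_)
open import Function.Bundles using (_⇔_; mk⇔; Equivalence)
import Function.Properties.Equivalence as ⇔
open import Relation.Binary.PropositionalEquality
  using (_≡_; _≢_; refl; sym; trans; cong; cong₂; subst; subst₂; module ≡-Reasoning)
open import Relation.Nullary using (¬_; yes; no)

private variable
  f g g′ : ℕ → ℕ
  k n m N N′ L : ℕ

-- Sums over windows and convolutions

rangeSum : (ℕ → ℕ) → ℕ → ℕ → ℕ
rangeSum f k zero = 0
rangeSum f k (suc L) = f k + rangeSum f (suc k) L

infixl 7 _⋆_
_⋆_ : (ℕ → ℕ) → (ℕ → ℕ) → ℕ → ℕ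
(f ⋆ g) zero = f 0 * g 0
(f ⋆ g) (suc n) = f (suc n) * g 0 + (f ⋆ (g ∘ suc)) n

rangeSum-cong : (∀ u → f u ≡ g u) → ∀ k L → rangeSum f k L ≡ rangeSum g k L
rangeSum-cong f≗g k zero = refl
rangeSum-cong f≗g k (suc L) = cong₂ _+_ (f≗g k) (rangeSum-cong f≗g (suc k) L)

rangeSum-+ : ∀ k L → rangeSum (λ u → f u + g u) k L ≡ rangeSum f k L + rangeSum g k L
rangeSum-+ k zero = refl
rangeSum-+ {f} {g} k (suc L) =
  trans (cong (f k + g k +_) (rangeSum-+ (suc k) L)) (interchange (f k) (g k) _ _)

rangeSum-*ˡ : ∀ c k L → rangeSum (λ u → c * f u) k L ≡ c * rangeSum f k L
rangeSum-*ˡ c k zero = sym (*-zeroʳ c)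
rangeSum-*ˡ {f} c k (suc L) =
  trans (cong (c * f k +_) (rangeSum-*ˡ c (suc k) L)) (sym (*-distribˡ-+ c (f k) _))

rangeSum-zero : ∀ k L → rangeSum (λ _ → 0) k L ≡ 0
rangeSum-zero k zero = refl
rangeSum-zero k (suc L) = rangeSum-zero (suc k) L

rangeSum-shift : ∀ k L → rangeSum f (suc k) L ≡ rangeSum (f ∘ suc) k L
rangeSum-shift k zero = refl
rangeSum-shift {f} k (suc L) = cong (f (suc k) +_) (rangeSum-shift (suc k) L)

⋆-congʳ : ∀ n → (∀ m → m ≤ n → g m ≡ g′ m) → (f ⋆ g) n ≡ (f ⋆ g′) n
⋆-congʳ {f = f} zero g≗g′ = cong (f 0 *_) (g≗g′ 0 z≤n)
⋆-congʳ {f = f} (suc n) g≗g′ =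
  cong₂ _+_ (cong (f (suc n) *_) (g≗g′ 0 z≤n)) (⋆-congʳ n λ m m≤n → g≗g′ (suc m) (s≤s m≤n))

⋆-distribʳ-+ : ∀ n → (f ⋆ (λ m → g m + g′ m)) n ≡ (f ⋆ g) n + (f ⋆ g′) n
⋆-distribʳ-+ {f} {g} {g′} zero = *-distribˡ-+ (f 0) (g 0) (g′ 0)
⋆-distribʳ-+ {f} {g} {g′} (suc n) =
  trans (cong₂ _+_ (*-distribˡ-+ (f (suc n)) (g 0) (g′ 0)) (⋆-distribʳ-+ n))
        (interchange (f (suc n) * g 0) _ _ _)

⋆-zeroʳ : ∀ n → (f ⋆ (λ _ → 0)) n ≡ 0
⋆-zeroʳ {f} zero = *-zeroʳ (f 0)
⋆-zeroʳ {f} (suc n) = cong₂ _+_ (*-zeroʳ (f (suc n))) (⋆-zeroʳ n)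

⋆-shiftʳ : ∀ g → g 0 ≡ 0 → ∀ n → (f ⋆ g) (suc n) ≡ (f ⋆ (g ∘ suc)) n
⋆-shiftʳ {f} g g0≡0 n =
  cong (_+ (f ⋆ (g ∘ suc)) n) (trans (cong (f (suc n) *_) g0≡0) (*-zeroʳ (f (suc n))))

rangeSum-⋆ : ∀ (G : ℕ → ℕ → ℕ) n k L →
             rangeSum (λ u → (f ⋆ G u) n) k L ≡ (f ⋆ (λ m → rangeSum (λ u → G u m) k L)) n
rangeSum-⋆ {f} G zero k L = rangeSum-*ˡ (f 0) k L
rangeSum-⋆ {f} G (suc n) k L = begin
  rangeSum (λ u → f (suc n) * G u 0 + (f ⋆ (G u ∘ suc)) n) k L
    ≡⟨ rangeSum-+ k L ⟩
  rangeSum (λ u → f (suc n) * G u 0) k L + rangeSum (λ u → (f ⋆ (G u ∘ suc)) n) k L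
    ≡⟨ cong₂ _+_ (rangeSum-*ˡ (f (suc n)) k L) (rangeSum-⋆ (λ u → G u ∘ suc) n k L) ⟩
  f (suc n) * rangeSum (λ u → G u 0) k L + (f ⋆ (λ m → rangeSum (λ u → G u (suc m)) k L)) n
    ∎
  where open ≡-Reasoning

-- Motzkin numbers

motzkins-suc : ∀ n → motzkins (suc n) ≡ M n ∷ motzkins n
motzkins-suc n with motzkins n
... | [] = refl
... | m ∷ ms = refl

M-head : ∀ n {m ms} → motzkins (suc n) ≡ m ∷ ms → M n ≡ m
M-head n eq rewrite eq = refl

motzkins-suc-suc : ∀ n → motzkins (suc (suc n)) ≡
                   (M n + sumProd (motzkins n) (reverse (motzkins n))) ∷ motzkins (suc n)
motzkins-suc-suc n rewrite motzkins-suc n = refl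

motzkins≡applyDownFrom : ∀ n → motzkins n ≡ applyDownFrom M n
motzkins≡applyDownFrom zero = refl
motzkins≡applyDownFrom (suc n) = trans (motzkins-suc n) (cong (M n ∷_) (motzkins≡applyDownFrom n))

reverse-applyDownFrom : ∀ n → reverse (applyDownFrom f n) ≡ applyUpTo f n
reverse-applyDownFrom zero = refl
reverse-applyDownFrom {f} (suc n) = begin
  reverse (f n ∷ applyDownFrom f n)  ≡⟨ unfold-reverse (f n) (applyDownFrom f n) ⟩
  reverse (applyDownFrom f n) ∷ʳ f n ≡⟨ cong (_∷ʳ f n) (reverse-applyDownFrom n) ⟩
  applyUpTo f n ∷ʳ f n               ≡⟨ applyUpTo-∷ʳ f n ⟩
  applyUpTo f (suc n)                ∎
  where open ≡-Reasoning

sumProd≡⋆ : ∀ n → sumProd (applyDownFrom f (suc n)) (applyUpTo g (suc n)) ≡ (f ⋆ g) n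
sumProd≡⋆ {f} {g} zero = +-identityʳ (f 0 * g 0)
sumProd≡⋆ {f} {g} (suc n) = cong (f (suc n) * g 0 +_) (sumProd≡⋆ n)

sumProd-motzkins : ∀ n → sumProd (motzkins (suc n)) (reverse (motzkins (suc n))) ≡ (M ⋆ M) n
sumProd-motzkins n
  rewrite motzkins≡applyDownFrom (suc n) | reverse-applyDownFrom {M} (suc n) = sumProd≡⋆ n

M-suc-suc : ∀ n → M (suc (suc n)) ≡ M (suc n) + (M ⋆ M) n
M-suc-suc n =
  trans (M-head (suc (suc n)) (motzkins-suc-suc (suc n))) (cong (M (suc n) +_) (sumProd-motzkins n))

-- T n k counts the permutations of [n] avoiding 1-23 and 21-3 of level k (enumValidAt), and
-- W n k those among the permutations of [n + 1] of level k + 1 whose maximum comes second.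

T W : ℕ → ℕ → ℕ
T zero zero = 1
T zero (suc k) = 0
T (suc n) zero = 0
T (suc n) (suc k) = T n k + W n k
W zero k = 0
W (suc n) k = rangeSum (T n) k (suc n)

⋆-T₀ : ∀ n → (f ⋆ (λ m → T m 0)) n ≡ f n
⋆-T₀ {f} zero = *-identityʳ (f 0)
⋆-T₀ {f} (suc n) =
  trans (cong₂ _+_ (*-identityʳ (f (suc n))) (⋆-zeroʳ n)) (+-identityʳ (f (suc n)))

⋆-T-suc : ∀ n → (f ⋆ (λ m → T m (suc k))) (suc n) ≡ (f ⋆ (λ m → T m k)) n + (f ⋆ (λ m → W m k)) n
⋆-T-suc {k = k} n = trans (⋆-shiftʳ (λ m → T m (suc k)) refl n) (⋆-distribʳ-+ n)

-- T n u = 0 for u > n, so a window of length at least n + 1 starting at k collects all of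
-- T n from k on.
WindowSum : ℕ → Set
WindowSum n = ∀ k L → suc n ≤ L → rangeSum (T n) k L ≡ (M ⋆ (λ m → T m k)) n

W-suc : WindowSum n → ∀ k → W (suc n) k ≡ (M ⋆ (λ m → T m k)) n
W-suc ws k = ws k _ ≤-refl

windowSum-W : (∀ {m} → m < n → WindowSum m) →
              ∀ k L → n ≤ L → rangeSum (W n) k L ≡ (M ⋆ (λ m → W m k)) n
windowSum-W {zero} _ k L _ = rangeSum-zero k L
windowSum-W {suc n} ws k L n<L = begin
  rangeSum (λ u → rangeSum (T n) u (suc n)) k L ≡⟨ rangeSum-cong (W-suc (ws ≤-refl)) k L ⟩
  rangeSum (λ u → (M ⋆ (λ m → T m u)) n) k L    ≡⟨ rangeSum-⋆ (λ u m → T m u) n k L ⟩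
  (M ⋆ (λ m → rangeSum (T m) k L)) n
    ≡⟨ ⋆-congʳ n (λ m m≤n → ws′ m≤n k L (≤-trans (s≤s m≤n) n<L)) ⟩
  (M ⋆ (λ m → (M ⋆ (λ m′ → T m′ k)) m)) n       ≡⟨ ⋆-congʳ n (λ m m≤n → W-suc (ws′ m≤n) k) ⟨
  (M ⋆ (λ m → W (suc m) k)) n                   ≡⟨ ⋆-shiftʳ (λ m → W m k) refl n ⟨
  (M ⋆ (λ m → W m k)) (suc n)                   ∎
  where
  open ≡-Reasoning
  ws′ : ∀ {m} → m ≤ n → WindowSum m
  ws′ m≤n = ws (s≤s m≤n)

M-suc≡M+⋆W : (∀ {m} → m < n → WindowSum m) → M (suc n) ≡ M n + (M ⋆ (λ m → W m 0)) n
M-suc≡M+⋆W {zero} _ = refl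
M-suc≡M+⋆W {suc n} ws = begin
  M (suc (suc n))                          ≡⟨ M-suc-suc n ⟩
  M (suc n) + (M ⋆ M) n                    ≡⟨ cong (M (suc n) +_) (⋆-congʳ n W-suc₀) ⟨
  M (suc n) + (M ⋆ (λ m → W (suc m) 0)) n  ≡⟨ cong (M (suc n) +_) (⋆-shiftʳ (λ m → W m 0) refl n) ⟨
  M (suc n) + (M ⋆ (λ m → W m 0)) (suc n)  ∎
  where
  open ≡-Reasoning
  W-suc₀ : ∀ m → m ≤ n → W (suc m) 0 ≡ M m
  W-suc₀ m m≤n = trans (W-suc (ws (s≤s m≤n)) 0) (⋆-T₀ m)

rangeSum-T-suc : (∀ {m} → m < suc n → WindowSum m) → ∀ k L → suc n ≤ L →
                 rangeSum (T (suc n)) (suc k) L ≡ (M ⋆ (λ m → T m k)) n + (M ⋆ (λ m → W m k)) n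
rangeSum-T-suc {n} ws k L n<L = begin
  rangeSum (T (suc n)) (suc k) L                ≡⟨ rangeSum-shift k L ⟩
  rangeSum (λ u → T n u + W n u) k L            ≡⟨ rangeSum-+ k L ⟩
  rangeSum (T n) k L + rangeSum (W n) k L
    ≡⟨ cong₂ _+_ (ws ≤-refl k L n<L) (windowSum-W (ws ∘ m<n⇒m<1+n) k L (<⇒≤ n<L)) ⟩
  (M ⋆ (λ m → T m k)) n + (M ⋆ (λ m → W m k)) n ∎
  where open ≡-Reasoning

windowSum : ∀ n → WindowSum n
windowSum = <-rec WindowSum step
  where
  step : ∀ n → (∀ {m} → m < n → WindowSum m) → WindowSum n
  step zero _ k (suc L) _ = cong (T 0 k +_) (trans (rangeSum-shift k L) (rangeSum-zero k L))
  step (suc n) ws zero (suc L) (s≤s n<L) = begin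
    rangeSum (T (suc n)) 1 L                       ≡⟨ rangeSum-T-suc ws 0 L n<L ⟩
    (M ⋆ (λ m → T m 0)) n + (M ⋆ (λ m → W m 0)) n  ≡⟨ cong (_+ (M ⋆ (λ m → W m 0)) n) (⋆-T₀ n) ⟩
    M n + (M ⋆ (λ m → W m 0)) n                    ≡⟨ M-suc≡M+⋆W (ws ∘ m<n⇒m<1+n) ⟨
    M (suc n)                                      ≡⟨ ⋆-T₀ (suc n) ⟨
    (M ⋆ (λ m → T m 0)) (suc n)                    ∎
    where open ≡-Reasoning
  step (suc n) ws (suc k) L n<L = trans (rangeSum-T-suc ws k L (<⇒≤ n<L)) (sym (⋆-T-suc n))

rangeSum-T : ∀ n → rangeSum (T n) 0 (suc n) ≡ M n
rangeSum-T n = trans (windowSum n 0 (suc n) ≤-refl) (⋆-T₀ n)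

-- Enumerations

-- HasCard n p q c unfolds to Enumeration (InS n p q) c.
Enumeration : {A : Set} → (A → Set) → ℕ → Set
Enumeration {A} P c = Σ (List A) λ xs → Unique xs × List.length xs ≡ c × (∀ x → x ∈ xs ⇔ P x)

Image : {A B : Set} → (A → B) → (A → Set) → B → Set
Image f P y = ∃[ x ] P x × f x ≡ y

InRange : ℕ → ℕ → ℕ → Set
InRange k L i = k ≤ i × i < k + L

module _ {A : Set} {P Q : A → Set} {c : ℕ} where

  enum-resp : (∀ x → P x ⇔ Q x) → Enumeration P c → Enumeration Q c
  enum-resp P⇔Q (xs , xs! , len , ∈⇔P) =
    xs , xs! , len , λ x → mk⇔ (to (P⇔Q x) ∘ to (∈⇔P x)) (from (∈⇔P x) ∘ from (P⇔Q x))
    where open Equivalence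

  enum-⊎ : ∀ {d} → Enumeration P c → Enumeration Q d → (∀ x → P x → ¬ Q x) →
           Enumeration (λ x → P x ⊎ Q x) (c + d)
  enum-⊎ (xs , xs! , len , ∈⇔P) (ys , ys! , len′ , ∈⇔Q) P∩Q=∅ =
    xs List.++ ys ,
    Unique.++⁺ xs! ys! (λ (x∈xs , x∈ys) → P∩Q=∅ _ (to (∈⇔P _) x∈xs) (to (∈⇔Q _) x∈ys)) ,
    trans (length-++ xs) (cong₂ _+_ len len′) ,
    λ x → mk⇔ (Sum.map (to (∈⇔P x)) (to (∈⇔Q x)) ∘ ∈-++⁻ xs)
               [ ∈-++⁺ˡ ∘ from (∈⇔P x) , ∈-++⁺ʳ xs ∘ from (∈⇔Q x) ]
    where open Equivalence

enum-∅ : {A : Set} {P : A → Set} → (∀ x → ¬ P x) → Enumeration P 0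
enum-∅ P=∅ = [] , [] , refl , λ x → mk⇔ (λ ()) (⊥-elim ∘ P=∅ x)

enum-image : {A B : Set} {P : A → Set} {c : ℕ} {f : A → B} → (∀ {x y} → f x ≡ f y → x ≡ y) →
             Enumeration P c → Enumeration (Image f P) c
enum-image {f = f} f-inj (xs , xs! , len , ∈⇔P) =
  List.map f xs , Unique.map⁺ f-inj xs! , trans (length-map f xs) len ,
  λ y → mk⇔ (λ y∈ → let x , x∈ , y≡fx = ∈-map⁻ f y∈ in x , to (∈⇔P x) x∈ , sym y≡fx)
            (λ { (x , Px , refl) → ∈-map⁺ f (from (∈⇔P x) Px) })
  where open Equivalence

enum-involution : {A : Set} {P Q : A → Set} {c : ℕ} (f : A → A) → (∀ x → f (f x) ≡ x) →
                  (∀ x → P x → Q (f x)) → (∀ x → Q x → P (f x)) →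
                  Enumeration P c → Enumeration Q c
enum-involution {Q = Q} f f∘f≗id P⇒Q∘f Q⇒P∘f = enum-resp image⇔Q ∘ enum-image f-injective
  where
  f-injective : ∀ {x y} → f x ≡ f y → x ≡ y
  f-injective {x} {y} fx≡fy = trans (sym (f∘f≗id x)) (trans (cong f fx≡fy) (f∘f≗id y))
  image⇔Q : ∀ y → Image f _ y ⇔ Q y
  image⇔Q y = mk⇔ (λ (x , Px , fx≡y) → subst Q fx≡y (P⇒Q∘f x Px))
                  (λ Qy → f y , Q⇒P∘f y Qy , f∘f≗id y)

inRange-start : ∀ k L → InRange k (suc L) k
inRange-start k L = ≤-refl , subst (k <_) (sym (+-suc k L)) (s≤s (m≤m+n k L))

inRange-suc⁺ : ∀ {k L i} → InRange (suc k) L i → InRange k (suc L) i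
inRange-suc⁺ {k} {L} {i} (k<i , i<1+k+L) = <⇒≤ k<i , subst (i <_) (sym (+-suc k L)) i<1+k+L

inRange-suc⁻ : ∀ {k L i} → InRange k (suc L) i → k ≡ i ⊎ InRange (suc k) L i
inRange-suc⁻ {k} {L} {i} (k≤i , i<k+1+L) with m≤n⇒m<n∨m≡n k≤i
... | inj₁ k<i = inj₂ (k<i , subst (i <_) (+-suc k L) i<k+1+L)
... | inj₂ k≡i = inj₁ k≡i

enum-range : {A : Set} {P : ℕ → A → Set} {c : ℕ → ℕ} →
             (∀ i → Enumeration (P i) (c i)) → (∀ {i j x} → P i x → P j x → i ≡ j) →
             ∀ k L → Enumeration (λ x → ∃[ i ] InRange k L i × P i x) (rangeSum c k L)
enum-range _ _ k zero =
  enum-∅ λ { _ (i , (k≤i , i<k+0) , _) → <⇒≱ (subst (i <_) (+-identityʳ k) i<k+0) k≤i }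
enum-range {P = P} E P-functional k (suc L) =
  enum-resp split (enum-⊎ (E k) (enum-range E P-functional (suc k) L) disjoint)
  where
  disjoint : ∀ x → P k x → ¬ (∃[ i ] InRange (suc k) L i × P i x)
  disjoint x Pk (i , (k<i , _) , Pi) = <⇒≢ k<i (P-functional Pk Pi)
  split : ∀ x → (P k x ⊎ ∃[ i ] InRange (suc k) L i × P i x) ⇔ (∃[ i ] InRange k (suc L) i × P i x)
  split x = mk⇔ [ (λ Pk → k , inRange-start k L , Pk) , (λ (i , i∈ , Pi) → i , inRange-suc⁺ i∈ , Pi) ]
                (λ (i , i∈ , Pi) → Sum.map (λ { refl → Pi }) (λ i∈′ → i , i∈′ , Pi) (inRange-suc⁻ i∈))

-- Occurrences of dashed patterns

module _ {A : Set} where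

  AnyAdjacent : (A → A → Set) → Vec A m → Set
  AnyAdjacent Q (a ∷ b ∷ v) = Q a b ⊎ AnyAdjacent Q (b ∷ v)
  AnyAdjacent Q _ = ⊥

  DashFirst : (A → A → A → Set) → Vec A m → Set
  DashFirst R [] = ⊥
  DashFirst R (a ∷ v) = AnyAdjacent (R a) v ⊎ DashFirst R v

  DashLast : (A → A → A → Set) → Vec A m → Set
  DashLast R (a ∷ b ∷ v) = Anyᵛ.Any (R a b) v ⊎ DashLast R (b ∷ v)
  DashLast R _ = ⊥

  -- Positional forms; ContainsDashFirst and ContainsDashLast of Defs are instances.

  AdjacentAt : (A → A → Set) → Vec A m → Set
  AdjacentAt {m} Q v = Σ (Fin m) λ j → Σ (Fin m) λ j′ →
    toℕ j′ ≡ suc (toℕ j) × Q (lookup v j) (lookup v j′)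

  DashFirstAt : (A → A → A → Set) → Vec A m → Set
  DashFirstAt {m} R v = Σ (Fin m) λ i → Σ (Fin m) λ j → Σ (Fin m) λ j′ →
    toℕ i < toℕ j × toℕ j′ ≡ suc (toℕ j) × R (lookup v i) (lookup v j) (lookup v j′)

  DashLastAt : (A → A → A → Set) → Vec A m → Set
  DashLastAt {m} R v = Σ (Fin m) λ i → Σ (Fin m) λ i′ → Σ (Fin m) λ k →
    toℕ i′ ≡ suc (toℕ i) × toℕ i′ < toℕ k × R (lookup v i) (lookup v i′) (lookup v k)

  module _ {Q : A → A → Set} where

    anyAdjacent⁺ : (v : Vec A m) → AdjacentAt Q v → AnyAdjacent Q v
    anyAdjacent⁺ (a ∷ b ∷ v) (zero , suc zero , refl , q) = inj₁ q
    anyAdjacent⁺ (a ∷ b ∷ v) (suc j , suc j′ , j′≡1+j , q) =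
      inj₂ (anyAdjacent⁺ (b ∷ v) (j , j′ , suc-injective j′≡1+j , q))
    anyAdjacent⁺ (a ∷ []) (zero , zero , () , _)
    anyAdjacent⁺ (a ∷ b ∷ v) (zero , zero , () , _)
    anyAdjacent⁺ (a ∷ b ∷ v) (zero , suc (suc j′) , () , _)
    anyAdjacent⁺ (a ∷ b ∷ v) (suc j , zero , () , _)

    anyAdjacent⁻ : (v : Vec A m) → AnyAdjacent Q v → AdjacentAt Q v
    anyAdjacent⁻ (a ∷ b ∷ v) (inj₁ q) = zero , suc zero , refl , q
    anyAdjacent⁻ (a ∷ b ∷ v) (inj₂ adj) =
      let j , j′ , j′≡1+j , q = anyAdjacent⁻ (b ∷ v) adj in suc j , suc j′ , cong suc j′≡1+j , q

  module _ {R : A → A → A → Set} where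

    dashFirst⁺ : (v : Vec A m) → DashFirstAt R v → DashFirst R v
    dashFirst⁺ (a ∷ v) (zero , suc j , suc j′ , _ , j′≡1+j , r) =
      inj₁ (anyAdjacent⁺ v (j , j′ , suc-injective j′≡1+j , r))
    dashFirst⁺ (a ∷ v) (suc i , suc j , suc j′ , s≤s i<j , j′≡1+j , r) =
      inj₂ (dashFirst⁺ v (i , j , j′ , i<j , suc-injective j′≡1+j , r))
    dashFirst⁺ (a ∷ v) (_ , zero , _ , () , _)
    dashFirst⁺ (a ∷ v) (_ , suc j , zero , _ , () , _)

    dashFirst⁻ : (v : Vec A m) → DashFirst R v → DashFirstAt R v
    dashFirst⁻ (a ∷ v) (inj₁ adj) =
      let j , j′ , j′≡1+j , r = anyAdjacent⁻ v adj
      in zero , suc j , suc j′ , s≤s z≤n , cong suc j′≡1+j , r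
    dashFirst⁻ (a ∷ v) (inj₂ occ) =
      let i , j , j′ , i<j , j′≡1+j , r = dashFirst⁻ v occ
      in suc i , suc j , suc j′ , s≤s i<j , cong suc j′≡1+j , r

    dashLast⁺ : (v : Vec A m) → DashLastAt R v → DashLast R v
    dashLast⁺ (a ∷ b ∷ v) (zero , suc zero , suc (suc k) , refl , _ , r) =
      inj₁ (toAny (∈-lookup k v) r)
    dashLast⁺ (a ∷ b ∷ v) (suc i , suc i′ , suc k , i′≡1+i , s≤s i′<k , r) =
      inj₂ (dashLast⁺ (b ∷ v) (i , i′ , k , suc-injective i′≡1+i , i′<k , r))
    dashLast⁺ (a ∷ []) (zero , zero , _ , () , _)
    dashLast⁺ (a ∷ b ∷ v) (zero , zero , _ , () , _)
    dashLast⁺ (a ∷ b ∷ v) (zero , suc (suc _) , _ , () , _)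
    dashLast⁺ (a ∷ b ∷ v) (zero , suc zero , zero , _ , () , _)
    dashLast⁺ (a ∷ b ∷ v) (zero , suc zero , suc zero , _ , s≤s () , _)
    dashLast⁺ (a ∷ b ∷ v) (suc i , zero , _ , () , _)
    dashLast⁺ (a ∷ b ∷ v) (suc i , suc i′ , zero , _ , () , _)

    dashLast⁻ : (v : Vec A m) → DashLast R v → DashLastAt R v
    dashLast⁻ (a ∷ b ∷ v) (inj₁ any) =
      zero , suc zero , suc (suc (Anyᵛ.index any)) , refl , s≤s (s≤s z≤n) , lookup-index any
    dashLast⁻ (a ∷ b ∷ v) (inj₂ occ) =
      let i , i′ , k , i′≡1+i , i′<k , r = dashLast⁻ (b ∷ v) occ
      in suc i , suc i′ , suc k , cong suc i′≡1+i , s≤s i′<k , r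

  anyAdjacent-mono : {Q Q′ : A → A → Set} → (∀ {a b} → Q a b → Q′ a b) →
                     (v : Vec A m) → AnyAdjacent Q v → AnyAdjacent Q′ v
  anyAdjacent-mono Q⇒Q′ (a ∷ b ∷ v) (inj₁ q) = inj₁ (Q⇒Q′ q)
  anyAdjacent-mono Q⇒Q′ (a ∷ b ∷ v) (inj₂ adj) = inj₂ (anyAdjacent-mono Q⇒Q′ (b ∷ v) adj)

  dashLast-∷ : {R : A → A → A → Set} {a : A} (v : Vec A m) → DashLast R v → DashLast R (a ∷ v)
  dashLast-∷ (b ∷ v) occ = inj₂ occ

module _ {A B : Set} (f : A → B) where

  anyAdjacent-map⁺ : ∀ {Q Q′} → (∀ {a b} → Q a b → Q′ (f a) (f b)) →
                     (v : Vec A m) → AnyAdjacent Q v → AnyAdjacent Q′ (Vec.map f v)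
  anyAdjacent-map⁺ Q⇒Q′ (a ∷ b ∷ v) (inj₁ q) = inj₁ (Q⇒Q′ q)
  anyAdjacent-map⁺ Q⇒Q′ (a ∷ b ∷ v) (inj₂ adj) = inj₂ (anyAdjacent-map⁺ Q⇒Q′ (b ∷ v) adj)

  anyAdjacent-map⁻ : ∀ {Q Q′} → (∀ {a b} → Q′ (f a) (f b) → Q a b) →
                     (v : Vec A m) → AnyAdjacent Q′ (Vec.map f v) → AnyAdjacent Q v
  anyAdjacent-map⁻ Q′⇒Q (a ∷ b ∷ v) (inj₁ q) = inj₁ (Q′⇒Q q)
  anyAdjacent-map⁻ Q′⇒Q (a ∷ b ∷ v) (inj₂ adj) = inj₂ (anyAdjacent-map⁻ Q′⇒Q (b ∷ v) adj)

  dashFirst-map⁺ : ∀ {R R′} → (∀ {a b c} → R a b c → R′ (f a) (f b) (f c)) →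
                   (v : Vec A m) → DashFirst R v → DashFirst R′ (Vec.map f v)
  dashFirst-map⁺ R⇒R′ (a ∷ v) (inj₁ adj) = inj₁ (anyAdjacent-map⁺ R⇒R′ v adj)
  dashFirst-map⁺ R⇒R′ (a ∷ v) (inj₂ occ) = inj₂ (dashFirst-map⁺ R⇒R′ v occ)

  dashFirst-map⁻ : ∀ {R R′} → (∀ {a b c} → R′ (f a) (f b) (f c) → R a b c) →
                   (v : Vec A m) → DashFirst R′ (Vec.map f v) → DashFirst R v
  dashFirst-map⁻ R′⇒R (a ∷ v) (inj₁ adj) = inj₁ (anyAdjacent-map⁻ R′⇒R v adj)
  dashFirst-map⁻ R′⇒R (a ∷ v) (inj₂ occ) = inj₂ (dashFirst-map⁻ R′⇒R v occ)

  dashLast-map⁺ : ∀ {R R′} → (∀ {a b c} → R a b c → R′ (f a) (f b) (f c)) →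
                  (v : Vec A m) → DashLast R v → DashLast R′ (Vec.map f v)
  dashLast-map⁺ R⇒R′ (a ∷ b ∷ v) (inj₁ any) = inj₁ (Anyᵛ.map⁺ (Anyᵛ.map R⇒R′ any))
  dashLast-map⁺ R⇒R′ (a ∷ b ∷ v) (inj₂ occ) = inj₂ (dashLast-map⁺ R⇒R′ (b ∷ v) occ)

  dashLast-map⁻ : ∀ {R R′} → (∀ {a b c} → R′ (f a) (f b) (f c) → R a b c) →
                  (v : Vec A m) → DashLast R′ (Vec.map f v) → DashLast R v
  dashLast-map⁻ R′⇒R (a ∷ b ∷ v) (inj₁ any) = inj₁ (Anyᵛ.map R′⇒R (Anyᵛ.map⁻ any))
  dashLast-map⁻ R′⇒R (a ∷ b ∷ v) (inj₂ occ) = inj₂ (dashLast-map⁻ R′⇒R (b ∷ v) occ)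

Distinct : {A : Set} → Vec A m → Set
Distinct {m} v = ∀ (i j : Fin m) → lookup v i ≡ lookup v j → i ≡ j

Omits : {A : Set} → A → Vec A m → Set
Omits a v = ∀ k → lookup v k ≢ a

module _ {A : Set} {a : A} {v : Vec A m} where

  distinct-tail : Distinct (a ∷ v) → Distinct v
  distinct-tail a∷v! i j vi≡vj = suc-injectiveᶠ (a∷v! (suc i) (suc j) vi≡vj)

  distinct-head : Distinct (a ∷ v) → Omits a v
  distinct-head a∷v! k vk≡a with a∷v! zero (suc k) (sym vk≡a)
  ... | ()

  distinct-∷ : Omits a v → Distinct v → Distinct (a ∷ v)
  distinct-∷ a∉v v! zero zero _ = refl
  distinct-∷ a∉v v! zero (suc j) a≡vj = ⊥-elim (a∉v j (sym a≡vj))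
  distinct-∷ a∉v v! (suc i) zero vi≡a = ⊥-elim (a∉v i vi≡a)
  distinct-∷ a∉v v! (suc i) (suc j) vi≡vj = cong suc (v! i j vi≡vj)

module _ {A B : Set} (f : A → B) (v : Vec A m) where

  distinct-map⁺ : (∀ {x y} → f x ≡ f y → x ≡ y) → Distinct v → Distinct (Vec.map f v)
  distinct-map⁺ f-inj v! i j eq =
    v! i j (f-inj (trans (sym (lookup-map i f v)) (trans eq (lookup-map j f v))))

  distinct-map⁻ : Distinct (Vec.map f v) → Distinct v
  distinct-map⁻ fv! i j eq =
    fv! i j (trans (lookup-map i f v) (trans (cong f eq) (sym (lookup-map j f v))))

  omits-map⁺ : (∀ {x y} → f x ≡ f y → x ≡ y) → ∀ {a} → Omits a v → Omits (f a) (Vec.map f v)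
  omits-map⁺ f-inj a∉v k eq = a∉v k (f-inj (trans (sym (lookup-map k f v)) eq))

  omits-map⁻ : ∀ {a} → Omits (f a) (Vec.map f v) → Omits a v
  omits-map⁻ fa∉fv k eq = fa∉fv k (trans (lookup-map k f v) (cong f eq))

map-injective : {A B : Set} {f : A → B} → (∀ {x y} → f x ≡ f y → x ≡ y) →
                {u u′ : Vec A m} → Vec.map f u ≡ Vec.map f u′ → u ≡ u′
map-injective f-inj {[]} {[]} _ = refl
map-injective f-inj {a ∷ u} {a′ ∷ u′} eq =
  let a≡a′ , u≡u′ = ∷-injective eq in cong₂ _∷_ (f-inj a≡a′) (map-injective f-inj u≡u′)

omits-punchIn : (i : Fin (suc N)) (u : Vec (Fin N) m) → Omits i (Vec.map (punchIn i) u)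
omits-punchIn i u k eq = punchInᵢ≢i i (lookup u k) (trans (sym (lookup-map k (punchIn i) u)) eq)

unpunch : (i : Fin (suc N)) (v : Vec (Fin (suc N)) m) → Omits i v →
          ∃[ u ] Vec.map (punchIn i) u ≡ v
unpunch i [] _ = [] , refl
unpunch i (a ∷ v) i∉a∷v =
  let u , ↑u≡v = unpunch i v (i∉a∷v ∘ suc)
  in punchOut (λ i≡a → i∉a∷v zero (sym i≡a)) ∷ u , cong₂ _∷_ (punchIn-punchOut _) ↑u≡v

fromℕ-maximal : (c : Fin (suc N)) → ¬ fromℕ N <ᶠ c
fromℕ-maximal {N} c top<c = <⇒≱ top<c (subst (toℕ c ≤_) (sym (toℕ-fromℕ N)) (toℕ≤pred[n] c))

<ᶠ-fromℕ : {a : Fin (suc N)} → a ≢ fromℕ N → a <ᶠ fromℕ N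
<ᶠ-fromℕ {N} {a} a≢top = subst (toℕ a <_) (sym (toℕ-fromℕ N))
  (≤∧≢⇒< (toℕ≤pred[n] a) (λ a≡N → a≢top (toℕ-injective (trans a≡N (sym (toℕ-fromℕ N))))))

below-max : (w : Vec (Fin (suc N)) m) → Distinct w → ∀ i j →
            lookup w i ≡ fromℕ N → j ≢ i → lookup w j <ᶠ lookup w i
below-max w w! i j wi≡top j≢i = subst (_ <ᶠ_) (sym wi≡top)
  (<ᶠ-fromℕ (λ wj≡top → j≢i (w! _ _ (trans wj≡top (sym wi≡top)))))

toℕ-punchIn-fromℕ : (a : Fin N) → toℕ (punchIn (fromℕ N) a) ≡ toℕ a
toℕ-punchIn-fromℕ {suc N} zero = refl
toℕ-punchIn-fromℕ {suc N} (suc a) = cong suc (toℕ-punchIn-fromℕ a)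

module _ (i : Fin (suc N)) {a b : Fin N} where

  punchIn-<ᶠ⁺ : a <ᶠ b → punchIn i a <ᶠ punchIn i b
  punchIn-<ᶠ⁺ a<b = ≰⇒> (λ ↑b≤↑a → <⇒≱ a<b (punchIn-cancel-≤ i b a ↑b≤↑a))

  punchIn-<ᶠ⁻ : punchIn i a <ᶠ punchIn i b → a <ᶠ b
  punchIn-<ᶠ⁻ ↑a<↑b = ≰⇒> (λ b≤a → <⇒≱ ↑a<↑b (punchIn-mono-≤ i b a b≤a))

≤⇒<ᶠ-punchIn : (x : Fin (suc N)) (a : Fin N) → toℕ x ≤ toℕ a → x <ᶠ punchIn x a
≤⇒<ᶠ-punchIn zero a _ = s≤s z≤n
≤⇒<ᶠ-punchIn (suc x) (suc a) (s≤s x≤a) = s≤s (≤⇒<ᶠ-punchIn x a x≤a)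

<ᶠ-punchIn⇒≤ : (x : Fin (suc N)) (a : Fin N) → x <ᶠ punchIn x a → toℕ x ≤ toℕ a
<ᶠ-punchIn⇒≤ zero a _ = z≤n
<ᶠ-punchIn⇒≤ (suc x) zero ()
<ᶠ-punchIn⇒≤ (suc x) (suc a) (s≤s x<↑a) = s≤s (<ᶠ-punchIn⇒≤ x a x<↑a)

-- Words avoiding 1-23 and 21-3

Has[1-23] Has[21-3] : Vec (Fin N) m → Set
Has[1-23] = DashFirst λ a b c → a <ᶠ b × b <ᶠ c
Has[21-3] = DashLast λ a b c → b <ᶠ a × a <ᶠ c

Valid : Vec (Fin N) m → Set
Valid v = Distinct v × ¬ Has[1-23] v × ¬ Has[21-3] v

valid-tail : {a : Fin N} {v : Vec (Fin N) m} → Valid (a ∷ v) → Valid v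
valid-tail (a∷v! , ¬123 , ¬213) = distinct-tail a∷v! , ¬123 ∘ inj₂ , ¬213 ∘ dashLast-∷ _

module _ (i : Fin (suc N)) (u : Vec (Fin N) m) where

  has[1-23]-punchIn⁺ : Has[1-23] u → Has[1-23] (Vec.map (punchIn i) u)
  has[1-23]-punchIn⁺ =
    dashFirst-map⁺ (punchIn i) (λ (a<b , b<c) → punchIn-<ᶠ⁺ i a<b , punchIn-<ᶠ⁺ i b<c) u

  has[1-23]-punchIn⁻ : Has[1-23] (Vec.map (punchIn i) u) → Has[1-23] u
  has[1-23]-punchIn⁻ =
    dashFirst-map⁻ (punchIn i) (λ (a<b , b<c) → punchIn-<ᶠ⁻ i a<b , punchIn-<ᶠ⁻ i b<c) u

  has[21-3]-punchIn⁺ : Has[21-3] u → Has[21-3] (Vec.map (punchIn i) u)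
  has[21-3]-punchIn⁺ =
    dashLast-map⁺ (punchIn i) (λ (b<a , a<c) → punchIn-<ᶠ⁺ i b<a , punchIn-<ᶠ⁺ i a<c) u

  has[21-3]-punchIn⁻ : Has[21-3] (Vec.map (punchIn i) u) → Has[21-3] u
  has[21-3]-punchIn⁻ =
    dashLast-map⁻ (punchIn i) (λ (b<a , a<c) → punchIn-<ᶠ⁻ i b<a , punchIn-<ᶠ⁻ i a<c) u

  distinct-punchIn : Distinct u → Distinct (Vec.map (punchIn i) u)
  distinct-punchIn = distinct-map⁺ (punchIn i) u (punchIn-injective i _ _)

has[1-23]-fromℕ∷⁻ : (v : Vec (Fin (suc N)) m) → Has[1-23] (fromℕ N ∷ v) → Has[1-23] v
has[1-23]-fromℕ∷⁻ v (inj₁ adj) = ⊥-elim (noAscentAboveMax v adj)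
  where
  noAscentAboveMax : (v : Vec (Fin (suc N)) m) → ¬ AnyAdjacent (λ b c → fromℕ N <ᶠ b × b <ᶠ c) v
  noAscentAboveMax (b ∷ c ∷ v) (inj₁ (top<b , _)) = fromℕ-maximal b top<b
  noAscentAboveMax (b ∷ c ∷ v) (inj₂ adj) = noAscentAboveMax (c ∷ v) adj
has[1-23]-fromℕ∷⁻ v (inj₂ occ) = occ

has[21-3]-fromℕ∷⁻ : (v : Vec (Fin (suc N)) m) → Has[21-3] (fromℕ N ∷ v) → Has[21-3] v
has[21-3]-fromℕ∷⁻ (b ∷ v) (inj₁ any) =
  let c , _ , top<c = Anyᵛ.satisfied any in ⊥-elim (fromℕ-maximal c top<c)
has[21-3]-fromℕ∷⁻ (b ∷ v) (inj₂ occ) = occ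

insMax₀ : Vec (Fin N) m → Vec (Fin (suc N)) (suc m)
insMax₀ {N} u = fromℕ N ∷ Vec.map (punchIn (fromℕ N)) u

insMax₁ : Vec (Fin N) (suc m) → Vec (Fin (suc N)) (suc (suc m))
insMax₁ {N} (a ∷ u) = punchIn (fromℕ N) a ∷ fromℕ N ∷ Vec.map (punchIn (fromℕ N)) u

infixr 5 _◂_
_◂_ : Fin (suc N) → Vec (Fin N) m → Vec (Fin (suc N)) (suc m)
x ◂ τ = x ∷ Vec.map (punchIn x) τ

module _ (u : Vec (Fin N) m) where

  valid-insMax₀⁻ : Valid (insMax₀ u) → Valid u
  valid-insMax₀⁻ (w! , ¬123 , ¬213) =
    distinct-map⁻ (punchIn (fromℕ N)) u (distinct-tail w!) ,
    ¬123 ∘ inj₂ ∘ has[1-23]-punchIn⁺ (fromℕ N) u ,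
    ¬213 ∘ dashLast-∷ _ ∘ has[21-3]-punchIn⁺ (fromℕ N) u

  valid-insMax₀⁺ : Valid u → Valid (insMax₀ u)
  valid-insMax₀⁺ (u! , ¬123 , ¬213) =
    distinct-∷ (omits-punchIn (fromℕ N) u) (distinct-punchIn (fromℕ N) u u!) ,
    ¬123 ∘ has[1-23]-punchIn⁻ (fromℕ N) u ∘ has[1-23]-fromℕ∷⁻ _ ,
    ¬213 ∘ has[21-3]-punchIn⁻ (fromℕ N) u ∘ has[21-3]-fromℕ∷⁻ _

module _ (a : Fin N) where

  private
    ↑ = punchIn (fromℕ N)

  has[1-23]-insMax₁⁻ : (u : Vec (Fin N) m) → Has[1-23] (insMax₁ (a ∷ u)) → Has[1-23] (a ∷ u)
  has[1-23]-insMax₁⁻ (_ ∷ _) (inj₁ (inj₁ (_ , top<c))) = ⊥-elim (fromℕ-maximal _ top<c)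
  has[1-23]-insMax₁⁻ u@(_ ∷ _) (inj₁ (inj₂ adj)) =
    inj₁ (anyAdjacent-map⁻ ↑
      (λ (a<b , b<c) → punchIn-<ᶠ⁻ (fromℕ N) a<b , punchIn-<ᶠ⁻ (fromℕ N) b<c) u adj)
  has[1-23]-insMax₁⁻ u (inj₂ occ) = inj₂ (has[1-23]-punchIn⁻ (fromℕ N) u (has[1-23]-fromℕ∷⁻ _ occ))

  has[1-23]-insMax₁⁺ : (u : Vec (Fin N) m) → Has[1-23] (a ∷ u) → Has[1-23] (insMax₁ (a ∷ u))
  has[1-23]-insMax₁⁺ u@(_ ∷ _) (inj₁ adj) =
    inj₁ (inj₂ (anyAdjacent-map⁺ ↑
      (λ (a<b , b<c) → punchIn-<ᶠ⁺ (fromℕ N) a<b , punchIn-<ᶠ⁺ (fromℕ N) b<c) u adj))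
  has[1-23]-insMax₁⁺ u (inj₂ occ) = inj₂ (inj₂ (has[1-23]-punchIn⁺ (fromℕ N) u occ))

  has[21-3]-insMax₁⁻ : (u : Vec (Fin N) m) → Has[21-3] (insMax₁ (a ∷ u)) → Has[21-3] u
  has[21-3]-insMax₁⁻ u (inj₁ any) =
    let _ , top<↑a , _ = Anyᵛ.satisfied any in ⊥-elim (fromℕ-maximal _ top<↑a)
  has[21-3]-insMax₁⁻ u (inj₂ occ) = has[21-3]-punchIn⁻ (fromℕ N) u (has[21-3]-fromℕ∷⁻ _ occ)

  has[21-3]-insMax₁⁺ : (u : Vec (Fin N) m) → Has[21-3] u → Has[21-3] (insMax₁ (a ∷ u))
  has[21-3]-insMax₁⁺ u = inj₂ ∘ dashLast-∷ _ ∘ has[21-3]-punchIn⁺ (fromℕ N) u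

  distinct-insMax₁⁻ : (u : Vec (Fin N) m) → Distinct (insMax₁ (a ∷ u)) → Distinct (a ∷ u)
  distinct-insMax₁⁻ u w! = distinct-∷ (omits-map⁻ ↑ u (distinct-head w! ∘ suc))
                                     (distinct-map⁻ ↑ u (distinct-tail (distinct-tail w!)))

  distinct-insMax₁⁺ : (u : Vec (Fin N) m) → Distinct (a ∷ u) → Distinct (insMax₁ (a ∷ u))
  distinct-insMax₁⁺ u a∷u! = distinct-∷ ↑a∉top∷↑u
    (distinct-∷ (omits-punchIn (fromℕ N) u) (distinct-punchIn (fromℕ N) u (distinct-tail a∷u!)))
    where
    ↑a∉top∷↑u : Omits (↑ a) (fromℕ N ∷ Vec.map ↑ u)
    ↑a∉top∷↑u zero = punchInᵢ≢i (fromℕ N) a ∘ sym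
    ↑a∉top∷↑u (suc k) = omits-map⁺ ↑ u (punchIn-injective (fromℕ N) _ _) (distinct-head a∷u!) k

AscentFrom : ℕ → Fin N → Fin N → Set
AscentFrom X b c = X ≤ toℕ b × b <ᶠ c

module _ (x : Fin (suc N)) (τ : Vec (Fin N) m) where

  has[1-23]-◂⁻ : Has[1-23] (x ◂ τ) → AnyAdjacent (AscentFrom (toℕ x)) τ ⊎ Has[1-23] τ
  has[1-23]-◂⁻ (inj₁ adj) =
    inj₁ (anyAdjacent-map⁻ (punchIn x) (λ (x<b , b<c) → <ᶠ-punchIn⇒≤ x _ x<b , punchIn-<ᶠ⁻ x b<c) τ adj)
  has[1-23]-◂⁻ (inj₂ occ) = inj₂ (has[1-23]-punchIn⁻ x τ occ)

  has[1-23]-◂⁺ : AnyAdjacent (AscentFrom (toℕ x)) τ ⊎ Has[1-23] τ → Has[1-23] (x ◂ τ)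
  has[1-23]-◂⁺ (inj₁ adj) =
    inj₁ (anyAdjacent-map⁺ (punchIn x) (λ (x≤b , b<c) → ≤⇒<ᶠ-punchIn x _ x≤b , punchIn-<ᶠ⁺ x b<c) τ adj)
  has[1-23]-◂⁺ (inj₂ occ) = inj₂ (has[1-23]-punchIn⁺ x τ occ)

ascentStep : ℕ → ℕ → ℕ → ℕ
ascentStep a b r with a <? b
... | yes _ = suc a
... | no _ = r

ascentBound : Vec (Fin N) m → ℕ
ascentBound [] = 0
ascentBound (a ∷ []) = 0
ascentBound (a ∷ b ∷ v) = ascentStep (toℕ a) (toℕ b) (ascentBound (b ∷ v))

ascentStep-≤ : ∀ {a b r} → b ≤ N → r ≤ N → ascentStep a b r ≤ N
ascentStep-≤ {a = a} {b} b≤N r≤N with a <? b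
... | yes a<b = ≤-trans a<b b≤N
... | no _ = r≤N

ascentBound≤ : (v : Vec (Fin N) m) → ascentBound v ≤ N
ascentBound≤ [] = z≤n
ascentBound≤ (a ∷ []) = z≤n
ascentBound≤ (a ∷ b ∷ v) = ascentStep-≤ (<⇒≤ (toℕ<n b)) (ascentBound≤ (b ∷ v))

ascentBound-map : {f : Fin N → Fin N′} → (∀ a → toℕ (f a) ≡ toℕ a) →
                  (v : Vec (Fin N) m) → ascentBound (Vec.map f v) ≡ ascentBound v
ascentBound-map f≗id [] = refl
ascentBound-map f≗id (a ∷ []) = refl
ascentBound-map {f = f} f≗id (a ∷ b ∷ v) =
  trans (cong₂ (λ x y → ascentStep x y (ascentBound (Vec.map f (b ∷ v)))) (f≗id a) (f≗id b))
        (cong (ascentStep (toℕ a) (toℕ b)) (ascentBound-map f≗id (b ∷ v)))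

ascentBound-insMax₀ : (u : Vec (Fin N) m) → ascentBound (insMax₀ u) ≡ ascentBound u
ascentBound-insMax₀ [] = refl
ascentBound-insMax₀ {N} (a ∷ u) with toℕ (fromℕ N) <? toℕ (punchIn (fromℕ N) a)
... | yes top<↑a = ⊥-elim (fromℕ-maximal _ top<↑a)
... | no _ = ascentBound-map toℕ-punchIn-fromℕ (a ∷ u)

ascentBound-insMax₁ : (a : Fin N) (u : Vec (Fin N) m) → ascentBound (insMax₁ (a ∷ u)) ≡ suc (toℕ a)
ascentBound-insMax₁ {N} a u with toℕ (punchIn (fromℕ N) a) <? toℕ (fromℕ N)
... | yes _ = cong suc (toℕ-punchIn-fromℕ a)
... | no ↑a≮top = ⊥-elim (↑a≮top (<ᶠ-fromℕ (punchInᵢ≢i (fromℕ N) a)))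

ascentBound≤⁺ : (X : ℕ) (v : Vec (Fin N) m) → ¬ AnyAdjacent (AscentFrom X) v → ascentBound v ≤ X
ascentBound≤⁺ X [] _ = z≤n
ascentBound≤⁺ X (a ∷ []) _ = z≤n
ascentBound≤⁺ X (a ∷ b ∷ v) ¬asc = step (ascentBound≤⁺ X (b ∷ v) (¬asc ∘ inj₂))
  where
  step : ∀ {r} → r ≤ X → ascentStep (toℕ a) (toℕ b) r ≤ X
  step r≤X with toℕ a <? toℕ b
  ... | no _ = r≤X
  ... | yes a<b with X ≤? toℕ a
  ...   | yes X≤a = ⊥-elim (¬asc (inj₁ (X≤a , a<b)))
  ...   | no X≰a = ≰⇒> X≰a

-- Avoiding 1-23 makes the bottoms of the ascents decrease, so the first one is the largest.
ascentBound≤⁻ : (X : ℕ) (v : Vec (Fin N) m) → ¬ Has[1-23] v → ascentBound v ≤ X →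
                ¬ AnyAdjacent (AscentFrom X) v
ascentBound≤⁻ X (a ∷ b ∷ v) ¬123 = step (ascentBound≤⁻ X (b ∷ v) (¬123 ∘ inj₂))
  where
  step : (ascentBound (b ∷ v) ≤ X → ¬ AnyAdjacent (AscentFrom X) (b ∷ v)) →
         ascentStep (toℕ a) (toℕ b) (ascentBound (b ∷ v)) ≤ X →
         ¬ AnyAdjacent (AscentFrom X) (a ∷ b ∷ v)
  step ih s≤X adj with toℕ a <? toℕ b
  step ih a<X (inj₁ (X≤a , _)) | yes _ = <⇒≱ a<X X≤a
  step ih a<X (inj₂ adj) | yes _ =
    ¬123 (inj₁ (anyAdjacent-mono (λ (X≤c , c<d) → <-≤-trans a<X X≤c , c<d) (b ∷ v) adj))
  step ih _ (inj₁ (_ , a<b)) | no a≮b = a≮b a<b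
  step ih r≤X (inj₂ adj) | no _ = ih r≤X adj

module _ (x : Fin (suc N)) (τ : Vec (Fin N) m) where

  valid-insMax₁⁺ : Valid τ → ascentBound τ ≤ toℕ x → Valid (insMax₁ (x ◂ τ))
  valid-insMax₁⁺ (τ! , ¬123 , ¬213) τ≤x =
    distinct-insMax₁⁺ x _ (distinct-∷ (omits-punchIn x τ) (distinct-punchIn x τ τ!)) ,
    [ ascentBound≤⁻ (toℕ x) τ ¬123 τ≤x , ¬123 ] ∘ has[1-23]-◂⁻ x τ ∘ has[1-23]-insMax₁⁻ x _ ,
    ¬213 ∘ has[21-3]-punchIn⁻ x τ ∘ has[21-3]-insMax₁⁻ x _

  valid-insMax₁⁻ : Valid (insMax₁ (x ◂ τ)) → Valid τ × ascentBound τ ≤ toℕ x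
  valid-insMax₁⁻ (w! , ¬123 , ¬213) =
    (distinct-map⁻ (punchIn x) τ (distinct-tail (distinct-insMax₁⁻ x _ w!)) ,
     ¬123 ∘ has[1-23]-insMax₁⁺ x _ ∘ has[1-23]-◂⁺ x τ ∘ inj₂ ,
     ¬213 ∘ has[21-3]-insMax₁⁺ x _ ∘ has[21-3]-punchIn⁺ x τ) ,
    ascentBound≤⁺ (toℕ x) τ (¬123 ∘ has[1-23]-insMax₁⁺ x _ ∘ has[1-23]-◂⁺ x τ ∘ inj₁)

max-occurs : (w : Vec (Fin (suc n)) (suc n)) → Distinct w → ∃[ p ] lookup w p ≡ fromℕ n
max-occurs {n} w w! with any? (λ p → lookup w p ≟ᶠ fromℕ n)
... | yes found = found
... | no ∄p =
  let i , j , i<j , eq = pigeonhole (n<1+n n) λ p → punchOut (top≢ p)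
  in ⊥-elim (<⇒≢ i<j (cong toℕ (w! i j (punchOut-injective (top≢ i) (top≢ j) eq))))
  where
  top≢ : ∀ p → fromℕ n ≢ lookup w p
  top≢ p top≡wp = ∄p (p , sym top≡wp)

max-in-front : (w : Vec (Fin (suc N)) (suc (suc m))) → Valid w → (p : Fin m) →
               lookup w (suc (suc p)) ≢ fromℕ N
max-in-front w@(a ∷ b ∷ c ∷ v) (w! , ¬123 , ¬213) zero c≡top with toℕ a <? toℕ b
... | yes a<b = ¬123 (inj₁ (inj₁ (a<b , below-max w w! (suc (suc zero)) (suc zero) c≡top λ ())))
... | no a≮b = ¬213 (inj₁ (here (b<a , below-max w w! (suc (suc zero)) zero c≡top λ ())))
  where
  b<a : b <ᶠ a
  b<a = ≤∧≢⇒< (≮⇒≥ a≮b) (λ b≡a → case w! zero (suc zero) (toℕ-injective (sym b≡a)) of λ ())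
max-in-front (a ∷ v) valid (suc p) = max-in-front v (valid-tail valid) p

insMax₀-surjective : (w : Vec (Fin (suc N)) (suc m)) → Distinct w → lookup w zero ≡ fromℕ N →
                     ∃[ u ] insMax₀ u ≡ w
insMax₀-surjective {N} (a ∷ t) w! a≡top =
  let u , ↑u≡t = unpunch (fromℕ N) t λ k tk≡top → distinct-head w! k (trans tk≡top (sym a≡top))
  in u , cong₂ _∷_ (sym a≡top) ↑u≡t

insMax₁◂-surjective : (w : Vec (Fin (suc (suc N))) (suc (suc m))) → Distinct w →
                      lookup w (suc zero) ≡ fromℕ (suc N) → ∃[ x ] ∃[ τ ] insMax₁ (x ◂ τ) ≡ w
insMax₁◂-surjective {N} (a ∷ b ∷ t) w! b≡top =
  let u , ↑u≡t = unpunch (fromℕ (suc N)) t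
                   λ k tk≡top → distinct-head (distinct-tail w!) k (trans tk≡top (sym b≡top))
      w≡ = cong₂ _∷_ (punchIn-punchOut top≢a) (cong₂ _∷_ (sym b≡top) ↑u≡t)
      x∷u! = distinct-insMax₁⁻ x u (subst Distinct (sym w≡) w!)
      τ , ↑τ≡u = unpunch x u (distinct-head x∷u!)
  in x , τ , trans (cong (insMax₁ ∘ (x ∷_)) ↑τ≡u) w≡
  where
  top≢a : fromℕ (suc N) ≢ a
  top≢a top≡a = case w! zero (suc zero) (trans (sym top≡a) (sym b≡top)) of λ ()
  x = punchOut top≢a

data Shape : (n : ℕ) → Word (suc n) → Set where
  maxFirst : (u : Word n) → Shape n (insMax₀ u)
  maxSecond : (x : Fin (suc n)) (τ : Word n) → Shape (suc n) (insMax₁ (x ◂ τ))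

shape : (w : Word (suc n)) → Valid w → Shape n w
shape w valid@(w! , _) with max-occurs w w!
... | zero , w₀≡top = let u , eq = insMax₀-surjective w w! w₀≡top in subst (Shape _) eq (maxFirst u)
shape {suc n} w (w! , _) | suc zero , w₁≡top =
  let x , τ , eq = insMax₁◂-surjective w w! w₁≡top in subst (Shape _) eq (maxSecond x τ)
shape w valid | suc (suc p) , w₂₊ₚ≡top = ⊥-elim (max-in-front w valid p w₂₊ₚ≡top)

-- Counting by level

level : Word n → ℕ
level {n} w = n ∸ ascentBound w

level-insMax₀ : (u : Word n) → level (insMax₀ u) ≡ suc (level u)
level-insMax₀ {n} u = trans (cong (suc n ∸_) (ascentBound-insMax₀ u)) (+-∸-assoc 1 (ascentBound≤ u))

level-insMax₁ : (x : Fin (suc n)) (τ : Word n) → level (insMax₁ (x ◂ τ)) ≡ suc (n ∸ toℕ x)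
level-insMax₁ {n} x τ = trans (cong (suc (suc n) ∸_) (ascentBound-insMax₁ x (Vec.map (punchIn x) τ)))
                              (+-∸-assoc 1 (toℕ≤pred[n] x))

ValidAt : (n k : ℕ) → Word n → Set
ValidAt n k w = Valid w × level w ≡ k

level-functional : ∀ {i j} {w : Word n} → ValidAt n i w → ValidAt n j w → i ≡ j
level-functional (_ , refl) (_ , refl) = refl

level-nonzero : (w : Word (suc n)) → ¬ ValidAt (suc n) 0 w
level-nonzero w (valid , level≡0) with shape w valid
... | maxFirst u = 1+n≢0 (trans (sym (level-insMax₀ u)) level≡0)
... | maxSecond x τ = 1+n≢0 (trans (sym (level-insMax₁ x τ)) level≡0)

-- By level-insMax₁ this is the first letter of a word with its maximum second and level k + 1.
-- For k > n the subtraction truncates, but then the window of levels in Built is empty.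
firstLetter : (n k : ℕ) → Fin (suc n)
firstLetter n k = fromℕ< (s≤s (m∸n≤m n k))

Built : (n k : ℕ) → Word (suc n) → Set
Built zero k _ = ⊥
Built (suc n) k =
  Image (λ τ → insMax₁ (firstLetter n k ◂ τ)) λ τ → ∃[ u ] InRange k (suc n) u × ValidAt n u τ

validAt-suc⁻ : (w : Word (suc n)) → ValidAt (suc n) (suc k) w →
               Image insMax₀ (ValidAt n k) w ⊎ Built n k w
validAt-suc⁻ w (valid , level≡) with shape w valid
... | maxFirst u =
  inj₁ (u , (valid-insMax₀⁻ u valid , suc-injective (trans (sym (level-insMax₀ u)) level≡)) , refl)
validAt-suc⁻ {k = k} w (valid , level≡) | maxSecond {n} x τ =
  inj₂ (τ , (level τ , (k≤level , level<k+1+n) , τ-valid , refl) ,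
        cong (λ y → insMax₁ (y ◂ τ)) (sym x≡))
  where
  τ-valid = proj₁ (valid-insMax₁⁻ x τ valid)
  τ≤x = proj₂ (valid-insMax₁⁻ x τ valid)
  k≡ : n ∸ toℕ x ≡ k
  k≡ = suc-injective (trans (sym (level-insMax₁ x τ)) level≡)
  k≤level : k ≤ level τ
  k≤level = subst (_≤ level τ) k≡ (∸-monoʳ-≤ n τ≤x)
  level<k+1+n : level τ < k + suc n
  level<k+1+n = <-≤-trans (s≤s (m∸n≤m n (ascentBound τ))) (m≤n+m (suc n) k)
  x≡ : x ≡ firstLetter n k
  x≡ = toℕ-injective (begin
    toℕ x                 ≡⟨ m∸[m∸n]≡n (toℕ≤pred[n] x) ⟨
    n ∸ (n ∸ toℕ x)       ≡⟨ cong (n ∸_) k≡ ⟩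
    n ∸ k                 ≡⟨ toℕ-fromℕ< _ ⟨
    toℕ (firstLetter n k) ∎)
    where open ≡-Reasoning

validAt-suc⁺ : (w : Word (suc n)) → Image insMax₀ (ValidAt n k) w ⊎ Built n k w →
               ValidAt (suc n) (suc k) w
validAt-suc⁺ w (inj₁ (u , (valid , refl) , refl)) = valid-insMax₀⁺ u valid , level-insMax₀ u
validAt-suc⁺ {suc n} {k} w (inj₂ (τ , (u , (k≤u , _) , valid , refl) , refl)) =
  valid-insMax₁⁺ x τ valid τ≤x ,
  trans (level-insMax₁ x τ) (cong suc (trans (cong (n ∸_) x≡) (m∸[m∸n]≡n k≤n)))
  where
  x = firstLetter n k
  x≡ : toℕ x ≡ n ∸ k
  x≡ = toℕ-fromℕ< _
  k≤n : k ≤ n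
  k≤n = ≤-trans k≤u (m∸n≤m n (ascentBound τ))
  τ≤x : ascentBound τ ≤ toℕ x
  τ≤x = subst (ascentBound τ ≤_) (sym x≡)
          (subst (_≤ n ∸ k) (m∸[m∸n]≡n (ascentBound≤ τ)) (∸-monoʳ-≤ n k≤u))

insMax₀-injective : {u u′ : Word n} → insMax₀ u ≡ insMax₀ u′ → u ≡ u′
insMax₀-injective {n} = map-injective (punchIn-injective (fromℕ n) _ _) ∘ ∷-injectiveʳ

insMax₁◂-injective : (x : Fin (suc n)) {τ τ′ : Word n} → insMax₁ (x ◂ τ) ≡ insMax₁ (x ◂ τ′) → τ ≡ τ′
insMax₁◂-injective {n} x =
  map-injective (punchIn-injective x _ _) ∘ map-injective (punchIn-injective (fromℕ (suc n)) _ _) ∘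
  ∷-injectiveʳ ∘ ∷-injectiveʳ

insMax₀-image-disjoint : ∀ n k w → Image insMax₀ (ValidAt n k) w → ¬ Built n k w
insMax₀-image-disjoint (suc n) k _ (u , _ , refl) (τ , _ , eq) =
  punchInᵢ≢i (fromℕ (suc n)) _ (∷-injectiveˡ eq)

enumValidAt : ∀ n k → Enumeration (ValidAt n k) (T n k)
enumBuilt : ∀ n k → Enumeration (Built n k) (W n k)

enumValidAt zero zero =
  [] ∷ [] , All.[] ∷ [] , refl ,
  λ { [] → mk⇔ (λ _ → ((λ { () }) , (λ ()) , (λ ())) , refl) (λ _ → here refl) }
enumValidAt zero (suc k) = enum-∅ λ { [] (_ , ()) }
enumValidAt (suc n) zero = enum-∅ level-nonzero
enumValidAt (suc n) (suc k) =
  enum-resp (λ w → mk⇔ (validAt-suc⁺ w) (validAt-suc⁻ w))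
    (enum-⊎ (enum-image insMax₀-injective (enumValidAt n k)) (enumBuilt n k)
            (insMax₀-image-disjoint n k))

enumBuilt zero k = enum-∅ λ _ ()
enumBuilt (suc n) k =
  enum-image (insMax₁◂-injective (firstLetter n k))
             (enum-range (enumValidAt n) level-functional k (suc n))

enumValid : ∀ n → Enumeration (Valid {n} {n}) (M n)
enumValid n = subst (Enumeration Valid) (rangeSum-T n)
  (enum-resp (λ w → mk⇔ (proj₁ ∘ proj₂ ∘ proj₂) (λ valid → level w , level∈ w , valid , refl))
    (enum-range (enumValidAt n) level-functional 0 (suc n)))
  where
  level∈ : (w : Word n) → InRange 0 (suc n) (level w)
  level∈ w = z≤n , s≤s (m∸n≤m n (ascentBound w))

module _ {a b c : Fin N} where

  sameOrder-123 : SameOrder (a , b , c) (𝟏 , 𝟐 , 𝟑) ⇔ (a <ᶠ b × b <ᶠ c)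
  sameOrder-123 = mk⇔
    (λ ((_ , a<b) , _ , (_ , b<c) , _) → a<b (s≤s z≤n) , b<c (s≤s (s≤s z≤n)))
    (λ (a<b , b<c) →
      ((λ _ → s≤s z≤n) , λ _ → a<b) , ((λ _ → s≤s z≤n) , λ _ → <-trans a<b b<c) ,
      ((λ _ → s≤s (s≤s z≤n)) , λ _ → b<c) , ((λ b<a → ⊥-elim (<-asym a<b b<a)) , λ ()) ,
      ((λ c<a → ⊥-elim (<-asym (<-trans a<b b<c) c<a)) , λ ()) ,
      ((λ c<b → ⊥-elim (<-asym b<c c<b)) , λ { (s≤s ()) }))

  sameOrder-213 : SameOrder (a , b , c) (𝟐 , 𝟏 , 𝟑) ⇔ (b <ᶠ a × a <ᶠ c)
  sameOrder-213 = mk⇔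
    (λ (_ , (_ , a<c) , _ , (_ , b<a) , _) → b<a (s≤s z≤n) , a<c (s≤s (s≤s z≤n)))
    (λ (b<a , a<c) →
      ((λ a<b → ⊥-elim (<-asym a<b b<a)) , λ ()) , ((λ _ → s≤s (s≤s z≤n)) , λ _ → a<c) ,
      ((λ _ → s≤s z≤n) , λ _ → <-trans b<a a<c) , ((λ _ → s≤s z≤n) , λ _ → b<a) ,
      ((λ c<a → ⊥-elim (<-asym a<c c<a)) , λ { (s≤s ()) }) ,
      ((λ c<b → ⊥-elim (<-asym (<-trans b<a a<c) c<b)) , λ ()))

InS⇔Valid : (w : Word n) → InS n (𝟏 - 𝟐 ∙ 𝟑) (𝟐 ∙ 𝟏 - 𝟑) w ⇔ Valid w
InS⇔Valid w = mk⇔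
  (λ (w! , ¬1-23 , ¬21-3) → w! , ¬1-23 ∘ has[1-23]⇒contains , ¬21-3 ∘ has[21-3]⇒contains)
  (λ (w! , ¬123 , ¬213) → w! , ¬123 ∘ contains⇒has[1-23] , ¬213 ∘ contains⇒has[21-3])
  where
  open Equivalence
  has[1-23]⇒contains : Has[1-23] w → Contains (𝟏 - 𝟐 ∙ 𝟑) w
  has[1-23]⇒contains occ =
    let i , j , j′ , i<j , j′≡ , r = dashFirst⁻ w occ
    in i , j , j′ , i<j , j′≡ , from sameOrder-123 r
  contains⇒has[1-23] : Contains (𝟏 - 𝟐 ∙ 𝟑) w → Has[1-23] w
  contains⇒has[1-23] (i , j , j′ , i<j , j′≡ , so) =
    dashFirst⁺ w (i , j , j′ , i<j , j′≡ , to sameOrder-123 so)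
  has[21-3]⇒contains : Has[21-3] w → Contains (𝟐 ∙ 𝟏 - 𝟑) w
  has[21-3]⇒contains occ =
    let i , i′ , k , i′≡ , i′<k , r = dashLast⁻ w occ
    in i , i′ , k , i′≡ , i′<k , from sameOrder-213 r
  contains⇒has[21-3] : Contains (𝟐 ∙ 𝟏 - 𝟑) w → Has[21-3] w
  contains⇒has[21-3] (i , i′ , k , i′≡ , i′<k , so) =
    dashLast⁺ w (i , i′ , k , i′≡ , i′<k , to sameOrder-213 so)

hasCard[1-23,21-3] : ∀ n → HasCard n (𝟏 - 𝟐 ∙ 𝟑) (𝟐 ∙ 𝟏 - 𝟑) (M n)
hasCard[1-23,21-3] n = enum-resp (λ w → ⇔.sym (InS⇔Valid w)) (enumValid n)

-- Symmetries

record WordSymmetry : Set where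
  field
    onWord : ∀ {n} → Word n → Word n
    onPattern : Pattern → Pattern
    onWord-involutive : ∀ {n} (w : Word n) → onWord (onWord w) ≡ w
    onPattern-involutive : ∀ p → onPattern (onPattern p) ≡ p
    isPerm-onWord : ∀ {n} {w : Word n} → IsPerm w → IsPerm (onWord w)
    contains-onWord : ∀ {n} p {w : Word n} → Contains p (onWord w) → Contains (onPattern p) w

hasCard-symmetry : (S : WordSymmetry) → let open WordSymmetry S in
                   ∀ {n} p q {c} → HasCard n p q c → HasCard n (onPattern p) (onPattern q) c
hasCard-symmetry S {n} p q = enum-involution onWord onWord-involutive forth back
  where
  open WordSymmetry S
  back : ∀ {p′ q′} w → InS n (onPattern p′) (onPattern q′) w → InS n p′ q′ (onWord w)
  back {p′} {q′} w (w! , ¬ψp′ , ¬ψq′) =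
    isPerm-onWord w! , ¬ψp′ ∘ contains-onWord p′ , ¬ψq′ ∘ contains-onWord q′
  forth : ∀ w → InS n p q w → InS n (onPattern p) (onPattern q) (onWord w)
  forth w = back w ∘ subst₂ (λ p q → InS n p q w) (sym (onPattern-involutive p))
                                                  (sym (onPattern-involutive q))

opposite-injective : {a b : Fin n} → opposite a ≡ opposite b → a ≡ b
opposite-injective {a = a} {b} eq =
  trans (sym (opposite-involutive a)) (trans (cong opposite eq) (opposite-involutive b))

opposite-adjacent : {j j′ : Fin n} → toℕ j′ ≡ suc (toℕ j) → toℕ (opposite j) ≡ suc (toℕ (opposite j′))
opposite-adjacent {suc n} {j} {j′} j′≡1+j rewrite opposite-prop j | opposite-prop j′ | j′≡1+j =
  +-∸-assoc 1 (subst (_≤ n) j′≡1+j (≤-pred (toℕ<n j′)))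

opposite-<ᶠ : {a b : Fin n} → a <ᶠ b → opposite b <ᶠ opposite a
opposite-<ᶠ {a = a} {b} a<b rewrite opposite-prop a | opposite-prop b = ∸-monoʳ-< (s≤s a<b) (toℕ<n b)

opposite-<ᶠ⁻ : {a b : Fin n} → opposite a <ᶠ opposite b → b <ᶠ a
opposite-<ᶠ⁻ {a = a} {b} = subst₂ _<ᶠ_ (opposite-involutive b) (opposite-involutive a) ∘ opposite-<ᶠ

module _ {a b c : Fin n} {x y z : Fin 3} where

  sameOrder-complement : SameOrder (opposite a , opposite b , opposite c) (x , y , z) →
                         SameOrder (a , b , c) (opposite x , opposite y , opposite z)
  sameOrder-complement (p₁₂ , p₁₃ , p₂₃ , p₂₁ , p₃₁ , p₃₂) =
    flip p₂₁ , flip p₃₁ , flip p₃₂ , flip p₁₂ , flip p₁₃ , flip p₂₃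
    where
    flip : ∀ {a b : Fin n} {x y : Fin 3} →
           (opposite b <ᶠ opposite a → y <ᶠ x) × (y <ᶠ x → opposite b <ᶠ opposite a) →
           (a <ᶠ b → opposite x <ᶠ opposite y) × (opposite x <ᶠ opposite y → a <ᶠ b)
    flip (to , from) = opposite-<ᶠ ∘ to ∘ opposite-<ᶠ , opposite-<ᶠ⁻ ∘ from ∘ opposite-<ᶠ⁻

  sameOrder-reverse : SameOrder (a , b , c) (x , y , z) → SameOrder (c , b , a) (z , y , x)
  sameOrder-reverse (p₁₂ , p₁₃ , p₂₃ , p₂₁ , p₃₁ , p₃₂) = p₃₂ , p₃₁ , p₂₁ , p₂₃ , p₁₃ , p₁₂

complementation : WordSymmetry
complementation = record
  { onWord = Vec.map opposite
  ; onPattern = complementᴾ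
  ; onWord-involutive = λ w →
      trans (sym (map-∘ opposite opposite w)) (trans (map-cong opposite-involutive w) (map-id w))
  ; onPattern-involutive = complementᴾ-involutive
  ; isPerm-onWord = λ {_} {w} → distinct-map⁺ opposite w opposite-injective
  ; contains-onWord = contains-complement
  }
  where
  complementᴾ : Pattern → Pattern
  complementᴾ (x - y ∙ z) = opposite x - opposite y ∙ opposite z
  complementᴾ (x ∙ y - z) = opposite x ∙ opposite y - opposite z
  complementᴾ-involutive : ∀ p → complementᴾ (complementᴾ p) ≡ p
  complementᴾ-involutive (x - y ∙ z)
    rewrite opposite-involutive x | opposite-involutive y | opposite-involutive z = refl
  complementᴾ-involutive (x ∙ y - z)
    rewrite opposite-involutive x | opposite-involutive y | opposite-involutive z = refl
  contains-complement : ∀ {n} p {w : Word n} → Contains p (Vec.map opposite w) →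
                        Contains (complementᴾ p) w
  contains-complement (x - y ∙ z) {w} (i , j , j′ , i<j , j′≡ , so)
    rewrite lookup-map i opposite w | lookup-map j opposite w | lookup-map j′ opposite w =
    i , j , j′ , i<j , j′≡ , sameOrder-complement so
  contains-complement (x ∙ y - z) {w} (i , i′ , k , i′≡ , i′<k , so)
    rewrite lookup-map i opposite w | lookup-map i′ opposite w | lookup-map k opposite w =
    i , i′ , k , i′≡ , i′<k , sameOrder-complement so

reversal : WordSymmetry
reversal = record
  { onWord = reverseWord
  ; onPattern = reverseᴾ
  ; onWord-involutive = λ w → trans
      (tabulate-cong λ i →
        trans (lookup-reverseWord w (opposite i)) (cong (lookup w) (opposite-involutive i)))
      (tabulate∘lookup w)
  ; onPattern-involutive = λ { (x - y ∙ z) → refl ; (x ∙ y - z) → refl }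
  ; isPerm-onWord = λ {_} {w} w! i j eq → opposite-injective (w! (opposite i) (opposite j)
      (trans (sym (lookup-reverseWord w i)) (trans eq (lookup-reverseWord w j))))
  ; contains-onWord = contains-reversal
  }
  where
  reverseWord : ∀ {n} → Word n → Word n
  reverseWord w = Vec.tabulate (lookup w ∘ opposite)
  lookup-reverseWord : ∀ {n} (w : Word n) i → lookup (reverseWord w) i ≡ lookup w (opposite i)
  lookup-reverseWord w = lookup∘tabulate (lookup w ∘ opposite)
  reverseᴾ : Pattern → Pattern
  reverseᴾ (x - y ∙ z) = z ∙ y - x
  reverseᴾ (x ∙ y - z) = z - y ∙ x
  contains-reversal : ∀ {n} p {w : Word n} → Contains p (reverseWord w) → Contains (reverseᴾ p) w
  contains-reversal (x - y ∙ z) {w} (i , j , j′ , i<j , j′≡1+j , so)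
    rewrite lookup-reverseWord w i | lookup-reverseWord w j | lookup-reverseWord w j′ =
    opposite j′ , opposite j , opposite i , opposite-adjacent j′≡1+j , opposite-<ᶠ i<j ,
    sameOrder-reverse so
  contains-reversal (x ∙ y - z) {w} (i , i′ , k , i′≡1+i , i′<k , so)
    rewrite lookup-reverseWord w i | lookup-reverseWord w i′ | lookup-reverseWord w k =
    opposite k , opposite i′ , opposite i , opposite-<ᶠ i′<k , opposite-adjacent i′≡1+i ,
    sameOrder-reverse so

mainTheorem12 : ∀ (n : ℕ) →
    HasCard n (𝟏 - 𝟐 ∙ 𝟑) (𝟐 ∙ 𝟏 - 𝟑) (M n) ×
    HasCard n (𝟑 - 𝟐 ∙ 𝟏) (𝟐 ∙ 𝟑 - 𝟏) (M n) ×
    HasCard n (𝟏 ∙ 𝟐 - 𝟑) (𝟏 - 𝟑 ∙ 𝟐) (M n) ×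
    HasCard n (𝟑 ∙ 𝟐 - 𝟏) (𝟑 - 𝟏 ∙ 𝟐) (M n)
mainTheorem12 n = S[1-23,21-3] , S[3-21,23-1] , S[12-3,1-32] , S[32-1,3-12]
  where
  S[1-23,21-3] = hasCard[1-23,21-3] n
  S[3-21,23-1] = hasCard-symmetry complementation (𝟏 - 𝟐 ∙ 𝟑) (𝟐 ∙ 𝟏 - 𝟑) S[1-23,21-3]
  S[32-1,3-12] = hasCard-symmetry reversal (𝟏 - 𝟐 ∙ 𝟑) (𝟐 ∙ 𝟏 - 𝟑) S[1-23,21-3]
  S[12-3,1-32] = hasCard-symmetry complementation (𝟑 ∙ 𝟐 - 𝟏) (𝟑 - 𝟏 ∙ 𝟐) S[32-1,3-12]
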